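{- Let $n$ be an integer with $n\ge 3$ and let $k\in\{0,1,\ldots,\lfloor n/2\rfloor-1\}$. Then $$\binom nk k^k(n-k)^{n-k}>e^{\frac {11}{12n^2}}\binom n{k+1}(k+1)^{k+1}(n-k-1)^{n-k-1}.$$
   Context: $\lfloor x\rfloor$ denotes the greatest integer not exceeding $x$. The convention $0^0=1$ is used. -}

module Defs where

open import Data.Nat as ℕ using (ℕ; zero; suc)
open import Data.Integer using (+_)
open import Data.Rational using (ℚ; _/_; _+_; _*_; 0ℚ; 1ℚ)

expTerm : ℚ → ℕ → ℚ
expTerm c zero    = 1ℚ
expTerm c (suc j) = expTerm c j * c * (+ 1 / suc j)

expPartial : ℚ → ℕ → ℚ
expPartial c zero    = 0ℚ
expPartial c (suc N) = expPartial c N + expTerm c N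

-- The exponent 11 / (12 n^2)  (only used for n ≥ 3; value at n = 0 irrelevant)
exponent : ℕ → ℚ
exponent zero    = 0ℚ
exponent (suc m) = + 11 / (12 ℕ.* suc m ℕ.* suc m)

-- "exp(c) * B < A" for naturals A, B, with exp(c) = Σ_j c^j/j! (= sup of the
-- partial sums, since c ≥ 0 here):  some rational q bounds every partial sum
-- and still satisfies q * B < A.
ExpMulLt : ℚ → ℕ → ℕ → Set
ExpMulLt c B A =
  Σ ℚ (λ q → ((N : ℕ) → expPartial c N Data.Rational.≤ q) × (q * (+ B / 1) Data.Rational.< (+ A / 1)))
  where open import Data.Product using (Σ; _×_)

module Submission where

-- Write t(k) = C(n,k) k^k (n-k)^(n-k) and e(m) = (1 + 1/m)^m. Since C(n,k+1) (k+1) = C(n,k) (n-k),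
-- t(k) / t(k+1) = e(n-k-1) / e(k), and as e is increasing and n-k-1 ≥ k+1 this is at least
-- e(k+1) / e(k). The third-order Bernoulli bound (1 - 1/a)^N ≥ 1 - N/a + C(N,2)/a² - C(N,3)/a³
-- at a = (k+1)² shows e(k+1) / e(k) > 1 + 2c for c = 11/(48 (k+1)²) ≥ 11/(12 n²), and
-- exp c ≤ 1 + 2c because, for c ≤ 1/2, each Taylor term of exp c is at most half the previous one.

open import Defs

module ExponentialBound where

  open import Data.Nat.Base as ℕ using (ℕ; zero; suc)
  import Data.Nat.Properties as ℕ
  open import Data.Integer.Base as ℤ using (+_)
  import Data.Integer.Properties as ℤ
  open import Data.Rational.Base
  open import Data.Rational.Properties
  import Data.Rational.Unnormalised.Base as ℚᵘ
  import Data.Rational.Unnormalised.Properties as ℚᵘ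
  open import Data.Rational.Solver using (module +-*-Solver)
  open import Data.Product.Base using (_,_)
  open import Relation.Binary.PropositionalEquality
  open import Data.Nat.Tactic.RingSolver using (solve-∀)

  private
    toℚᵘ-/ : ∀ i d .{{_ : ℕ.NonZero d}} → toℚᵘ (i / d) ℚᵘ.≃ ℚᵘ.mkℚᵘ i (ℕ.pred d)
    toℚᵘ-/ i (suc d) = toℚᵘ-fromℚᵘ (ℚᵘ.mkℚᵘ i d)

  fraction-≤ : ∀ a b d e .{{_ : ℕ.NonZero d}} .{{_ : ℕ.NonZero e}} →
               a ℕ.* e ℕ.≤ b ℕ.* d → + a / d ≤ + b / e
  fraction-≤ a b d@(suc _) e@(suc _) ae≤bd = toℚᵘ-cancel-≤
    (ℚᵘ.≤-respˡ-≃ (ℚᵘ.≃-sym (toℚᵘ-/ (+ a) d)) (ℚᵘ.≤-respʳ-≃ (ℚᵘ.≃-sym (toℚᵘ-/ (+ b) e))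
      (ℚᵘ.*≤* (subst₂ ℤ._≤_ (ℤ.pos-* a e) (ℤ.pos-* b d) (ℤ.+≤+ ae≤bd)))))

  fraction-< : ∀ a b d e .{{_ : ℕ.NonZero d}} .{{_ : ℕ.NonZero e}} →
               a ℕ.* e ℕ.< b ℕ.* d → + a / d < + b / e
  fraction-< a b d@(suc _) e@(suc _) ae<bd = toℚᵘ-cancel-<
    (ℚᵘ.<-respˡ-≃ (ℚᵘ.≃-sym (toℚᵘ-/ (+ a) d)) (ℚᵘ.<-respʳ-≃ (ℚᵘ.≃-sym (toℚᵘ-/ (+ b) e))
      (ℚᵘ.*<* (subst₂ ℤ._<_ (ℤ.pos-* a e) (ℤ.pos-* b d) (ℤ.+<+ ae<bd)))))

  fraction-+ : ∀ a b d e .{{_ : ℕ.NonZero d}} .{{_ : ℕ.NonZero e}} →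
               + a / d + + b / e ≡ (+ (a ℕ.* e ℕ.+ b ℕ.* d) / (d ℕ.* e)) {{ℕ.m*n≢0 d e}}
  fraction-+ a b d@(suc d-1) e@(suc e-1) = toℚᵘ-injective (begin
    toℚᵘ (+ a / d + + b / e)
      ≈⟨ toℚᵘ-homo-+ (+ a / d) (+ b / e) ⟩
    toℚᵘ (+ a / d) ℚᵘ.+ toℚᵘ (+ b / e)
      ≈⟨ ℚᵘ.+-cong (toℚᵘ-/ (+ a) d) (toℚᵘ-/ (+ b) e) ⟩
    ℚᵘ.mkℚᵘ (+ a) d-1 ℚᵘ.+ ℚᵘ.mkℚᵘ (+ b) e-1
      ≈⟨ ℚᵘ.≃-reflexive (cong (λ i → ℚᵘ.mkℚᵘ i (ℕ.pred (d ℕ.* e))) numerator) ⟩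
    ℚᵘ.mkℚᵘ (+ (a ℕ.* e ℕ.+ b ℕ.* d)) (ℕ.pred (d ℕ.* e))
      ≈⟨ ℚᵘ.≃-sym (toℚᵘ-/ _ (d ℕ.* e)) ⟩
    toℚᵘ (+ (a ℕ.* e ℕ.+ b ℕ.* d) / (d ℕ.* e))
      ∎)
    where
    open import Relation.Binary.Reasoning.Setoid ℚᵘ.≃-setoid
    numerator : + a ℤ.* + e ℤ.+ + b ℤ.* + d ≡ + (a ℕ.* e ℕ.+ b ℕ.* d)
    numerator = cong₂ ℤ._+_ (sym (ℤ.pos-* a e)) (sym (ℤ.pos-* b d))

  fraction-* : ∀ a b d e .{{_ : ℕ.NonZero d}} .{{_ : ℕ.NonZero e}} →
               (+ a / d) * (+ b / e) ≡ (+ (a ℕ.* b) / (d ℕ.* e)) {{ℕ.m*n≢0 d e}}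
  fraction-* a b d@(suc d-1) e@(suc e-1) = toℚᵘ-injective (begin
    toℚᵘ ((+ a / d) * (+ b / e))
      ≈⟨ toℚᵘ-homo-* (+ a / d) (+ b / e) ⟩
    toℚᵘ (+ a / d) ℚᵘ.* toℚᵘ (+ b / e)
      ≈⟨ ℚᵘ.*-cong (toℚᵘ-/ (+ a) d) (toℚᵘ-/ (+ b) e) ⟩
    ℚᵘ.mkℚᵘ (+ a) d-1 ℚᵘ.* ℚᵘ.mkℚᵘ (+ b) e-1
      ≈⟨ ℚᵘ.≃-reflexive (cong (λ i → ℚᵘ.mkℚᵘ i (ℕ.pred (d ℕ.* e))) (sym (ℤ.pos-* a b))) ⟩
    ℚᵘ.mkℚᵘ (+ (a ℕ.* b)) (ℕ.pred (d ℕ.* e))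
      ≈⟨ ℚᵘ.≃-sym (toℚᵘ-/ _ (d ℕ.* e)) ⟩
    toℚᵘ (+ (a ℕ.* b) / (d ℕ.* e))
      ∎)
    where open import Relation.Binary.Reasoning.Setoid ℚᵘ.≃-setoid

  module _ {c : ℚ} (0≤c : 0ℚ ≤ c) (2c≤1 : c + c ≤ 1ℚ) where

    private
      instance
        c-nonNeg : NonNegative c
        c-nonNeg = nonNegative 0≤c

      1/[1+n]-nonNeg : ∀ n → NonNegative (+ 1 / suc n)
      1/[1+n]-nonNeg n = normalize-nonNeg 1 (suc n)

      1/[1+n]≤1 : ∀ n → + 1 / suc n ≤ 1ℚ
      1/[1+n]≤1 n = fraction-≤ 1 1 (suc n) 1 (ℕ.s≤s ℕ.z≤n)

      p≤p+q : ∀ {p q} → 0ℚ ≤ q → p ≤ p + q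
      p≤p+q {p} 0≤q = ≤-trans (≤-reflexive (sym (+-identityʳ p))) (+-monoʳ-≤ p 0≤q)

    expTerm-nonNeg : ∀ N → NonNegative (expTerm c N)
    expTerm-nonNeg zero    = _
    expTerm-nonNeg (suc N) = nonNeg*nonNeg⇒nonNeg (t * c) {{t*c-nonNeg}} (+ 1 / suc N) {{1/[1+n]-nonNeg N}}
      where
      t = expTerm c N
      t*c-nonNeg : NonNegative (t * c)
      t*c-nonNeg = nonNeg*nonNeg⇒nonNeg t {{expTerm-nonNeg N}} c

    -- Each new term is at most half the previous one, so twice the last term
    -- bounds the rest of the series.
    expPartial+2expTerm≤1+2c : ∀ N →
      expPartial c (suc N) + (expTerm c (suc N) + expTerm c (suc N)) ≤ 1ℚ + (c + c)
    expPartial+2expTerm≤1+2c zero = ≤-reflexive (solve 1 (λ c →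
      (con 0ℚ :+ con 1ℚ) :+ (con 1ℚ :* c :* con 1ℚ :+ con 1ℚ :* c :* con 1ℚ) := con 1ℚ :+ (c :+ c)) refl c)
      where open +-*-Solver
    expPartial+2expTerm≤1+2c (suc N) = begin
      P + T + (T′ + T′)             ≡⟨ regroup P T c u ⟩
      P + T + T * ((c + c) * u)     ≤⟨ +-monoʳ-≤ (P + T) halving ⟩
      P + T + T                     ≡⟨ +-assoc P T T ⟩
      P + (T + T)                   ≤⟨ expPartial+2expTerm≤1+2c N ⟩
      1ℚ + (c + c)                  ∎
      where
      open ≤-Reasoning
      open +-*-Solver
      P  = expPartial c (suc N)
      T  = expTerm c (suc N)
      u  = + 1 / suc (suc N)
      T′ = T * c * u
      regroup : ∀ p t c u → p + t + (t * c * u + t * c * u) ≡ p + t + t * ((c + c) * u)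
      regroup = solve 4 (λ p t c u →
        p :+ t :+ (t :* c :* u :+ t :* c :* u) := p :+ t :+ t :* ((c :+ c) :* u)) refl
      2cu≤1 : (c + c) * u ≤ 1ℚ
      2cu≤1 = begin
        (c + c) * u   ≤⟨ *-monoʳ-≤-nonNeg u {{1/[1+n]-nonNeg (suc N)}} 2c≤1 ⟩
        1ℚ * u        ≡⟨ *-identityˡ u ⟩
        u             ≤⟨ 1/[1+n]≤1 (suc N) ⟩
        1ℚ            ∎
      halving : T * ((c + c) * u) ≤ T
      halving = begin
        T * ((c + c) * u)  ≤⟨ *-monoˡ-≤-nonNeg T {{expTerm-nonNeg (suc N)}} 2cu≤1 ⟩
        T * 1ℚ             ≡⟨ *-identityʳ T ⟩
        T                  ∎

    expPartial≤1+2c : ∀ N → expPartial c N ≤ 1ℚ + (c + c)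
    expPartial≤1+2c zero    =
      nonNegative⁻¹ (1ℚ + (c + c)) {{nonNeg+nonNeg⇒nonNeg 1ℚ (c + c) {{nonNeg+nonNeg⇒nonNeg c c}}}}
    expPartial≤1+2c (suc N) =
      ≤-trans (p≤p+q (nonNegative⁻¹ (T + T) {{nonNeg+nonNeg⇒nonNeg T T}})) (expPartial+2expTerm≤1+2c N)
      where
      T = expTerm c (suc N)
      instance _ = expTerm-nonNeg (suc N)

  expMulLt-exponent : ∀ n D B A → 22 ℕ.≤ D → D ℕ.≤ 12 ℕ.* n ℕ.* n →
                      (D ℕ.+ 22) ℕ.* B ℕ.< D ℕ.* A → ExpMulLt (exponent n) B A
  expMulLt-exponent zero    (suc _) _ _ _ () _
  expMulLt-exponent (suc n) D@(suc _) B A 22≤D D≤12n² D+22B<DA =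
    1ℚ + (c + c) , expPartial≤1+2c 0≤c 2c≤1 , [1+2c]B<A
    where
    12n² = 12 ℕ.* suc n ℕ.* suc n
    c = exponent (suc n)
    0≤c : 0ℚ ≤ c
    0≤c = nonNegative⁻¹ c {{normalize-nonNeg 11 12n²}}
    c≤½ : c ≤ ½
    c≤½ = fraction-≤ 11 1 12n² 2
            (ℕ.≤-trans 22≤D (ℕ.≤-trans D≤12n² (ℕ.≤-reflexive (sym (ℕ.*-identityˡ 12n²)))))
    2c≤1 : c + c ≤ 1ℚ
    2c≤1 = +-mono-≤ c≤½ c≤½
    c≤11/D : c ≤ + 11 / D
    c≤11/D = fraction-≤ 11 11 12n² D (ℕ.*-monoʳ-≤ 11 D≤12n²)
    numerator = 1 ℕ.* (D ℕ.* D) ℕ.+ (11 ℕ.* D ℕ.+ 11 ℕ.* D) ℕ.* 1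
    denominator = 1 ℕ.* (D ℕ.* D) ℕ.* 1
    [1+22/D]B≡ : (1ℚ + (+ 11 / D + + 11 / D)) * (+ B / 1) ≡ + (numerator ℕ.* B) / denominator
    [1+22/D]B≡ = begin-equality
      (1ℚ + (+ 11 / D + + 11 / D)) * (+ B / 1)
        ≡⟨ cong (λ r → (1ℚ + r) * (+ B / 1)) (fraction-+ 11 11 D D) ⟩
      (1ℚ + + (11 ℕ.* D ℕ.+ 11 ℕ.* D) / (D ℕ.* D)) * (+ B / 1)
        ≡⟨ cong (_* (+ B / 1)) (fraction-+ 1 (11 ℕ.* D ℕ.+ 11 ℕ.* D) 1 (D ℕ.* D)) ⟩
      (+ numerator / (1 ℕ.* (D ℕ.* D))) * (+ B / 1)
        ≡⟨ fraction-* numerator B (1 ℕ.* (D ℕ.* D)) 1 ⟩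
      + (numerator ℕ.* B) / denominator
        ∎
      where open ≤-Reasoning
    cross-multiplied : numerator ℕ.* B ℕ.* 1 ℕ.< A ℕ.* denominator
    cross-multiplied = subst₂ ℕ._<_ (lhs D B) (rhs D A) (ℕ.*-monoʳ-< D D+22B<DA)
      where
      lhs : ∀ D B → D ℕ.* ((D ℕ.+ 22) ℕ.* B)
                      ≡ (1 ℕ.* (D ℕ.* D) ℕ.+ (11 ℕ.* D ℕ.+ 11 ℕ.* D) ℕ.* 1) ℕ.* B ℕ.* 1
      lhs = solve-∀
      rhs : ∀ D A → D ℕ.* (D ℕ.* A) ≡ A ℕ.* (1 ℕ.* (D ℕ.* D) ℕ.* 1)
      rhs = solve-∀
    [1+2c]B<A : (1ℚ + (c + c)) * (+ B / 1) < + A / 1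
    [1+2c]B<A = begin-strict
      (1ℚ + (c + c)) * (+ B / 1)
        ≤⟨ *-monoʳ-≤-nonNeg (+ B / 1) {{normalize-nonNeg B 1}} (+-monoʳ-≤ 1ℚ (+-mono-≤ c≤11/D c≤11/D)) ⟩
      (1ℚ + (+ 11 / D + + 11 / D)) * (+ B / 1)
        ≡⟨ [1+22/D]B≡ ⟩
      + (numerator ℕ.* B) / denominator
        <⟨ fraction-< (numerator ℕ.* B) A denominator 1 cross-multiplied ⟩
      + A / 1
        ∎
      where open ≤-Reasoning

open import Data.Nat
open import Data.Nat.Properties
open import Data.Nat.Combinatorics using (_C_; nC1≡n; nCk+nC[k+1]≡[n+1]C[k+1]; nCk≡n!/k![n-k]!; k![n∸k]!∣n!)
open import Data.Nat.DivMod using (m/n*n≡m; m/n*n≤m)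
open import Data.Nat.Tactic.RingSolver using (solve-∀)
open import Relation.Binary.PropositionalEquality
open import Algebra.Properties.CommutativeSemigroup *-commutativeSemigroup
  using (interchange; xy∙z≈xz∙y; xy∙z≈x∙zy)

^-distribʳ-* : ∀ m n o → (m * n) ^ o ≡ m ^ o * n ^ o
^-distribʳ-* m n zero    = refl
^-distribʳ-* m n (suc o) = begin-equality
  m * n * (m * n) ^ o        ≡⟨ cong (m * n *_) (^-distribʳ-* m n o) ⟩
  m * n * (m ^ o * n ^ o)    ≡⟨ interchange m n (m ^ o) (n ^ o) ⟩
  m * m ^ o * (n * n ^ o)    ∎
  where open ≤-Reasoning

n^n>0 : ∀ n → n ^ n > 0
n^n>0 zero      = z<s
n^n>0 n@(suc _) = m^n>0 n n

[1+m]²≡1+m[2+m] : ∀ m → suc m * suc m ≡ suc (m * suc (suc m))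
[1+m]²≡1+m[2+m] = solve-∀

cross-≤-trans : ∀ {p q r s t u} → s > 0 → p * s ≤ r * q → r * u ≤ t * s → p * u ≤ t * q
cross-≤-trans {p} {q} {r} {s} {t} {u} s>0 ps≤rq ru≤ts = *-cancelʳ-≤ (p * u) (t * q) s (begin
  p * u * s   ≡⟨ xy∙z≈xz∙y p u s ⟩
  p * s * u   ≤⟨ *-monoˡ-≤ u ps≤rq ⟩
  r * q * u   ≡⟨ xy∙z≈xz∙y r q u ⟩
  r * u * q   ≤⟨ *-monoˡ-≤ q ru≤ts ⟩
  t * s * q   ≡⟨ xy∙z≈xz∙y t s q ⟩
  t * q * s   ∎)
  where
  open ≤-Reasoning
  instance _ = >-nonZero s>0

scaled-gap-< : ∀ {x c u v w p} → p > 0 → x + c * v < c * u → p * u ≤ w + p * v → x * p < c * w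
scaled-gap-< {x} {c} {u} {v} {w} {p} p>0 x+cv<cu pu≤w+pv =
  +-cancelʳ-< (c * (p * v)) (x * p) (c * w) (begin-strict
    x * p + c * (p * v)    ≡⟨ factor x c v p ⟩
    (x + c * v) * p        <⟨ *-monoˡ-< p x+cv<cu ⟩
    c * u * p              ≡⟨ xy∙z≈x∙zy c u p ⟩
    c * (p * u)            ≤⟨ *-monoʳ-≤ c pu≤w+pv ⟩
    c * (w + p * v)        ≡⟨ *-distribˡ-+ c w (p * v) ⟩
    c * w + c * (p * v)    ∎)
  where
  open ≤-Reasoning
  instance _ = >-nonZero p>0
  factor : ∀ x c v p → x * p + c * (p * v) ≡ (x + c * v) * p
  factor = solve-∀

m≤n/2⇒m+m≤n : ∀ {m n} → m ≤ n / 2 → m + m ≤ n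
m≤n/2⇒m+m≤n {m} {n} m≤n/2 = begin
  m + m      ≡⟨ cong (m +_) (+-identityʳ m) ⟨
  2 * m      ≡⟨ *-comm 2 m ⟩
  m * 2      ≤⟨ *-monoˡ-≤ 2 m≤n/2 ⟩
  n / 2 * 2  ≤⟨ m/n*n≤m n 2 ⟩
  n          ∎
  where open ≤-Reasoning

-- Binomial coefficients

[1+n]C2≡n+nC2 : ∀ n → suc n C 2 ≡ n + n C 2
[1+n]C2≡n+nC2 n = trans (sym (nCk+nC[k+1]≡[n+1]C[k+1] n 1)) (cong (_+ n C 2) (nC1≡n n))

[1+n]C3≡nC2+nC3 : ∀ n → suc n C 3 ≡ n C 2 + n C 3
[1+n]C3≡nC2+nC3 n = sym (nCk+nC[k+1]≡[n+1]C[k+1] n 2)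

2*[1+n]C2≡[1+n]*n : ∀ n → 2 * (suc n C 2) ≡ suc n * n
2*[1+n]C2≡[1+n]*n zero    = refl
2*[1+n]C2≡[1+n]*n (suc n) = begin-equality
  2 * (suc (suc n) C 2)       ≡⟨ cong (2 *_) ([1+n]C2≡n+nC2 (suc n)) ⟩
  2 * (suc n + suc n C 2)     ≡⟨ *-distribˡ-+ 2 (suc n) (suc n C 2) ⟩
  2 * suc n + 2 * (suc n C 2) ≡⟨ cong (2 * suc n +_) (2*[1+n]C2≡[1+n]*n n) ⟩
  2 * suc n + suc n * n       ≡⟨ factor n ⟩
  suc (suc n) * suc n         ∎
  where
  open ≤-Reasoning
  factor : ∀ n → 2 * suc n + suc n * n ≡ suc (suc n) * suc n
  factor = solve-∀

6*[2+n]C3≡[2+n]*[1+n]*n : ∀ n → 6 * (suc (suc n) C 3) ≡ suc (suc n) * suc n * n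
6*[2+n]C3≡[2+n]*[1+n]*n zero    = refl
6*[2+n]C3≡[2+n]*[1+n]*n (suc n) = begin-equality
  6 * (suc (suc (suc n)) C 3)
    ≡⟨ cong (6 *_) ([1+n]C3≡nC2+nC3 (suc (suc n))) ⟩
  6 * (suc (suc n) C 2 + suc (suc n) C 3)
    ≡⟨ split (suc (suc n) C 2) (suc (suc n) C 3) ⟩
  3 * (2 * (suc (suc n) C 2)) + 6 * (suc (suc n) C 3)
    ≡⟨ cong₂ (λ x y → 3 * x + y) (2*[1+n]C2≡[1+n]*n (suc n)) (6*[2+n]C3≡[2+n]*[1+n]*n n) ⟩
  3 * (suc (suc n) * suc n) + suc (suc n) * suc n * n
    ≡⟨ factor n ⟩
  suc (suc (suc n)) * suc (suc n) * suc n
    ∎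
  where
  open ≤-Reasoning
  split : ∀ x y → 6 * (x + y) ≡ 3 * (2 * x) + 6 * y
  split = solve-∀
  factor : ∀ n → 3 * (suc (suc n) * suc n) + suc (suc n) * suc n * n
                   ≡ suc (suc (suc n)) * suc (suc n) * suc n
  factor = solve-∀

nCk*[k!*[n∸k]!]≡n! : ∀ {n k} → k ≤ n → (n C k) * (k ! * (n ∸ k) !) ≡ n !
nCk*[k!*[n∸k]!]≡n! {n} {k} k≤n = begin-equality
  (n C k) * (k ! * (n ∸ k) !)                 ≡⟨ cong (_* (k ! * (n ∸ k) !)) (nCk≡n!/k![n-k]! k≤n) ⟩
  n ! / (k ! * (n ∸ k) !) * (k ! * (n ∸ k) !) ≡⟨ m/n*n≡m (k![n∸k]!∣n! k≤n) ⟩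
  n !                                         ∎
  where
  open ≤-Reasoning
  instance _ = k !* (n ∸ k) !≢0

nCk>0 : ∀ {n k} → k ≤ n → n C k > 0
nCk>0 {n} {k} k≤n = >-nonZero⁻¹ (n C k) {{m*n≢0⇒m≢0 (n C k) {{product-nonZero}}}}
  where
  product-nonZero : NonZero ((n C k) * (k ! * (n ∸ k) !))
  product-nonZero = subst NonZero (sym (nCk*[k!*[n∸k]!]≡n! k≤n)) (n !≢0)

nC[1+k]*[1+k]≡nCk*[n∸k] : ∀ {n k} → k < n → (n C suc k) * suc k ≡ (n C k) * (n ∸ k)
nC[1+k]*[1+k]≡nCk*[n∸k] {n} {k} k<n = *-cancelʳ-≡ _ _ (k ! * r !) {{k !* r !≢0}} (begin-equality
  (n C suc k) * suc k * (k ! * r !)   ≡⟨ absorb (n C suc k) k (k !) (r !) ⟩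
  (n C suc k) * (suc k ! * r !)       ≡⟨ nCk*[k!*[n∸k]!]≡n! k<n ⟩
  n !                                 ≡⟨ nCk*[k!*[n∸k]!]≡n! (<⇒≤ k<n) ⟨
  (n C k) * (k ! * (n ∸ k) !)         ≡⟨ cong (λ d → (n C k) * (k ! * d !)) n∸k≡1+r ⟩
  (n C k) * (k ! * suc r !)           ≡⟨ release (n C k) r (k !) (r !) ⟩
  (n C k) * suc r * (k ! * r !)       ≡⟨ cong (λ d → (n C k) * d * (k ! * r !)) n∸k≡1+r ⟨
  (n C k) * (n ∸ k) * (k ! * r !)     ∎)
  where
  open ≤-Reasoning
  r = n ∸ suc k
  n∸k≡1+r : n ∸ k ≡ suc r
  n∸k≡1+r = +-∸-assoc 1 k<n
  absorb : ∀ c k f g → c * suc k * (f * g) ≡ c * (suc k * f * g)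
  absorb = solve-∀
  release : ∀ c r f g → c * (f * (suc r * g)) ≡ c * suc r * (f * g)
  release = solve-∀

-- Bernoulli inequalities

-- (1 - 1/a)^N ≥ 1 - N/a, multiplied through by a^(N+1).
bernoulli : ∀ {a b} → a ≡ suc b → ∀ N → a ^ suc N ≤ a * b ^ N + N * a ^ N
bernoulli refl zero    = ≤-reflexive (sym (+-identityʳ _))
bernoulli {a} {b} refl (suc N) = begin
  a * (a * a ^ N)                                     ≡⟨ split b (a ^ N) ⟩
  b * (a * a ^ N) + a * a ^ N                         ≤⟨ +-monoˡ-≤ (a * a ^ N) (*-monoʳ-≤ b (bernoulli refl N)) ⟩
  b * (a * b ^ N + N * a ^ N) + a * a ^ N             ≤⟨ m≤m+n _ (N * a ^ N) ⟩
  b * (a * b ^ N + N * a ^ N) + a * a ^ N + N * a ^ N ≡⟨ collect b (b ^ N) (a ^ N) N ⟩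
  a * (b * b ^ N) + suc N * (a * a ^ N)               ∎
  where
  open ≤-Reasoning
  split : ∀ b P → suc b * (suc b * P) ≡ b * (suc b * P) + suc b * P
  split = solve-∀
  collect : ∀ b Q P N → b * (suc b * Q + N * P) + suc b * P + N * P ≡ suc b * (b * Q) + suc N * (suc b * P)
  collect = solve-∀

-- (1 - 1/a)^N ≥ 1 - N/a + C(N,2)/a² - C(N,3)/a³, multiplied through by a^(N+3).
bernoulli₃ : ∀ {a b} → a ≡ suc b → ∀ N →
             a ^ N * (a * a * a + (N C 2) * a) ≤ a * a * a * b ^ N + a ^ N * (N * a * a + N C 3)
bernoulli₃ {a} refl zero = ≤-reflexive (base a)
  where
  base : ∀ a → 1 * (a * a * a + 0 * a) ≡ a * a * a * 1 + 1 * (0 * a * a + 0)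
  base = solve-∀
bernoulli₃ {a} {b} refl (suc N) = +-cancelʳ-≤ (b * (P * v)) _ _ (begin
  a * P * (a * a * a + (suc N C 2) * a) + b * (P * v)
    ≡⟨ cong (λ x → a * P * (a * a * a + x * a) + b * (P * v)) ([1+n]C2≡n+nC2 N) ⟩
  a * P * (a * a * a + (N + T₂) * a) + b * (P * v)
    ≤⟨ m≤m+n _ (P * T₃) ⟩
  a * P * (a * a * a + (N + T₂) * a) + b * (P * v) + P * T₃
    ≡⟨ regroup b P N T₂ T₃ ⟩
  a * P * (suc N * a * a + (T₂ + T₃)) + b * (P * u)
    ≤⟨ +-monoʳ-≤ (a * P * (suc N * a * a + (T₂ + T₃))) (*-monoʳ-≤ b (bernoulli₃ refl N)) ⟩
  a * P * (suc N * a * a + (T₂ + T₃)) + b * (a * a * a * b ^ N + P * v)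
    ≡⟨ expand b P N T₂ T₃ (b ^ N) ⟩
  a * a * a * (b * b ^ N) + a * P * (suc N * a * a + (T₂ + T₃)) + b * (P * v)
    ≡⟨ cong (λ x → a * a * a * (b * b ^ N) + a * P * (suc N * a * a + x) + b * (P * v)) (sym ([1+n]C3≡nC2+nC3 N)) ⟩
  a * a * a * (b * b ^ N) + a * P * (suc N * a * a + suc N C 3) + b * (P * v) ∎)
  where
  open ≤-Reasoning
  P  = a ^ N
  T₂ = N C 2
  T₃ = N C 3
  u  = a * a * a + T₂ * a
  v  = N * a * a + T₃
  regroup : ∀ b P N T₂ T₃ →
    let a = suc b in
    a * P * (a * a * a + (N + T₂) * a) + b * (P * (N * a * a + T₃)) + P * T₃
      ≡ a * P * (suc N * a * a + (T₂ + T₃)) + b * (P * (a * a * a + T₂ * a))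
  regroup = solve-∀
  expand : ∀ b P N T₂ T₃ Q →
    let a = suc b in
    a * P * (suc N * a * a + (T₂ + T₃)) + b * (a * a * a * Q + P * (N * a * a + T₃))
      ≡ a * a * a * (b * Q) + a * P * (suc N * a * a + (T₂ + T₃)) + b * (P * (N * a * a + T₃))
  expand = solve-∀

-- The sequence (1 + 1/m)^m

-- Writing e(m) = (1 + 1/m)^m, where e(0) = 1 as 0^0 = 1, the inequality
-- suc a ^ a * b ^ b ≤ suc b ^ b * a ^ a says e(a) ≤ e(b). The step is Bernoulli
-- at a = (m+1)², b = m(m+2), N = m+1.
euler-step : ∀ m → suc m ^ m * suc m ^ suc m ≤ suc (suc m) ^ suc m * m ^ m
euler-step zero      = s≤s z≤n
euler-step m@(suc _) = *-cancelˡ-≤ (s * s * m) (+-cancelʳ-≤ (s * (S * S)) _ _ (begin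
  s * s * m * (s ^ m * S) + s * (S * S)
    ≡⟨ collect m (s ^ m) ⟩
  s * s * (S * S)
    ≡⟨ cong (s * s *_) (^-distribʳ-* s s s) ⟨
  s * s * (s * s) ^ s
    ≤⟨ bernoulli ([1+m]²≡1+m[2+m] m) s ⟩
  s * s * (m * suc s) ^ s + s * (s * s) ^ s
    ≡⟨ cong₂ (λ x y → s * s * x + s * y) (^-distribʳ-* m (suc s) s) (^-distribʳ-* s s s) ⟩
  s * s * (m ^ s * suc s ^ s) + s * (S * S)
    ≡⟨ cong (_+ s * (S * S)) (rearrange m (m ^ m) (suc s ^ s)) ⟩
  s * s * m * (suc s ^ s * m ^ m) + s * (S * S)
    ∎))
  where
  open ≤-Reasoning
  s = suc m
  S = s ^ s
  collect : ∀ m Q → suc m * suc m * m * (Q * (suc m * Q)) + suc m * ((suc m * Q) * (suc m * Q))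
                      ≡ suc m * suc m * ((suc m * Q) * (suc m * Q))
  collect = solve-∀
  rearrange : ∀ m M X → suc m * suc m * (m * M * X) ≡ suc m * suc m * m * (X * M)
  rearrange = solve-∀

euler-mono : ∀ {a b} → a ≤ b → suc a ^ a * b ^ b ≤ suc b ^ b * a ^ a
euler-mono {a} a≤b = go (≤⇒≤′ a≤b)
  where
  go : ∀ {b} → a ≤′ b → suc a ^ a * b ^ b ≤ suc b ^ b * a ^ a
  go ≤′-refl              = ≤-refl
  go (≤′-step {b} a≤′b) =
    cross-≤-trans {suc a ^ a} {a ^ a} {suc b ^ b} {b ^ b} {suc (suc b) ^ suc b} (n^n>0 b) (go a≤′b) (euler-step b)

euler-successor-polynomial : ∀ z → let k = suc z ; y = suc k ; a = y * y in
  6 * ((48 * a + 22) * k * (a * a)) + 48 * y * (6 * (y * a * a) + y * k * z)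
    < 48 * y * (6 * (a * a * a) + 3 * (y * k) * a)
euler-successor-polynomial z = <-≤-trans (m<m+n _ (s≤s z≤n)) (≤-reflexive (sym (difference z)))
  where
  difference : ∀ z → let k = suc z ; y = suc k ; a = y * y in
    48 * y * (6 * (a * a * a) + 3 * (y * k) * a)
      ≡ 6 * ((48 * a + 22) * k * (a * a)) + 48 * y * (6 * (y * a * a) + y * k * z)
        + (192 + 384 * z + 288 * z * z + 144 * z * z * z + 60 * z * z * z * z + 12 * z * z * z * z * z)
  difference = solve-∀

-- e(k+1) / e(k) > 1 + 22/D for D = 48(k+1)²: after cancelling, bernoulli₃ at a = (k+1)²,
-- N = k+1 reduces it to euler-successor-polynomial.
euler-successor-ratio : ∀ k → (48 * (suc k * suc k) + 22) * (suc k ^ k * suc k ^ suc k)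
                      < 48 * (suc k * suc k) * (k ^ k * suc (suc k) ^ suc k)
euler-successor-ratio zero    = ≤ᵇ⇒≤ 71 96 _
euler-successor-ratio (suc z) = *-cancelˡ-< (k * y * (a * a)) _ _ (begin-strict
  k * y * (a * a) * ((48 * a + 22) * (y ^ k * y ^ y)) ≡⟨ expand-lhs ⟩
  (48 * a + 22) * k * (a * a) * a ^ y                <⟨ scaled-gap-< {c = 48 * y} (m^n>0 a y) gap bernoulli-bound ⟩
  48 * y * (a * a * a * (k * suc y) ^ y)             ≡⟨ expand-rhs ⟨
  k * y * (a * a) * (48 * a * (k ^ k * suc y ^ y))   ∎)
  where
  open ≤-Reasoning
  k = suc z
  y = suc k
  a = y * y
  bernoulli-bound : a ^ y * (a * a * a + (y C 2) * a) ≤ a * a * a * (k * suc y) ^ y + a ^ y * (y * a * a + y C 3)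
  bernoulli-bound = bernoulli₃ ([1+m]²≡1+m[2+m] k) y
  gap : (48 * a + 22) * k * (a * a) + 48 * y * (y * a * a + y C 3) < 48 * y * (a * a * a + (y C 2) * a)
  gap = *-cancelˡ-< 6 _ _ (begin-strict
    6 * (X + c * (y * a * a + y C 3))
      ≡⟨ spread X c (y * a * a) (y C 3) ⟩
    6 * X + c * (6 * (y * a * a) + 6 * (y C 3))
      ≡⟨ cong (λ t → 6 * X + c * (6 * (y * a * a) + t)) (6*[2+n]C3≡[2+n]*[1+n]*n z) ⟩
    6 * X + c * (6 * (y * a * a) + y * k * z)
      <⟨ euler-successor-polynomial z ⟩
    c * (6 * (a * a * a) + 3 * (y * k) * a)
      ≡⟨ cong (λ t → c * (6 * (a * a * a) + 3 * t * a)) (2*[1+n]C2≡[1+n]*n k) ⟨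
    c * (6 * (a * a * a) + 3 * (2 * (y C 2)) * a)
      ≡⟨ gather c (a * a * a) (y C 2) a ⟩
    6 * (c * (a * a * a + (y C 2) * a))
      ∎)
    where
    X = (48 * a + 22) * k * (a * a)
    c = 48 * y
    spread : ∀ X c V T → 6 * (X + c * (V + T)) ≡ 6 * X + c * (6 * V + 6 * T)
    spread = solve-∀
    gather : ∀ c A T a → c * (6 * A + 3 * (2 * T) * a) ≡ 6 * (c * (A + T * a))
    gather = solve-∀
  expand-lhs : k * y * (a * a) * ((48 * a + 22) * (y ^ k * y ^ y)) ≡ (48 * a + 22) * k * (a * a) * a ^ y
  expand-lhs = trans (regroup z (y ^ k))
                     (cong ((48 * a + 22) * k * (a * a) *_) (sym (^-distribʳ-* y y y)))
    where
    regroup : ∀ z Y → let k = suc z ; y = suc k ; a = y * y in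
      k * y * (a * a) * ((48 * a + 22) * (Y * (y * Y))) ≡ (48 * a + 22) * k * (a * a) * ((y * Y) * (y * Y))
    regroup = solve-∀
  expand-rhs : k * y * (a * a) * (48 * a * (k ^ k * suc y ^ y)) ≡ 48 * y * (a * a * a * (k * suc y) ^ y)
  expand-rhs = trans (regroup z (k ^ k) (suc y ^ y))
                     (cong (λ t → 48 * y * (a * a * a * t)) (sym (^-distribʳ-* k (suc y) y)))
    where
    regroup : ∀ z K W → let k = suc z ; y = suc k ; a = y * y in
      k * y * (a * a) * (48 * a * (K * W)) ≡ 48 * y * (a * a * a * ((k * K) * W))
    regroup = solve-∀

euler-ratio : ∀ {k m} → suc k ≤ m →
  (48 * (suc k * suc k) + 22) * (suc k ^ k * m ^ m) < 48 * (suc k * suc k) * (k ^ k * suc m ^ m)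
euler-ratio {k} {m} 1+k≤m = *-cancelʳ-< (y ^ y) _ _ (begin-strict
  (D + 22) * (y ^ k * m ^ m) * y ^ y      ≡⟨ swap (D + 22) (y ^ k) (m ^ m) (y ^ y) ⟩
  (D + 22) * (y ^ k * y ^ y) * m ^ m      <⟨ *-monoˡ-< (m ^ m) (euler-successor-ratio k) ⟩
  D * (k ^ k * suc y ^ y) * m ^ m         ≡⟨ regroup D (k ^ k) (suc y ^ y) (m ^ m) ⟩
  D * k ^ k * (suc y ^ y * m ^ m)         ≤⟨ *-monoʳ-≤ (D * k ^ k) (euler-mono 1+k≤m) ⟩
  D * k ^ k * (suc m ^ m * y ^ y)         ≡⟨ regroup D (k ^ k) (suc m ^ m) (y ^ y) ⟨
  D * (k ^ k * suc m ^ m) * y ^ y         ∎)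
  where
  open ≤-Reasoning
  y = suc k
  D = 48 * (y * y)
  instance _ = >-nonZero (n^n>0 m)
  swap : ∀ a b c d → a * (b * c) * d ≡ a * (b * d) * c
  swap = solve-∀
  regroup : ∀ a b c d → a * (b * c) * d ≡ a * b * (c * d)
  regroup = solve-∀

binomial-term-ratio : ∀ {n k} → suc k + suc k ≤ n →
  (48 * (suc k * suc k) + 22) * ((n C suc k) * suc k ^ suc k * (n ∸ suc k) ^ (n ∸ suc k))
    < 48 * (suc k * suc k) * ((n C k) * k ^ k * (n ∸ k) ^ (n ∸ k))
binomial-term-ratio {n} {k} 2[1+k]≤n = begin-strict
  (D + 22) * ((n C suc k) * y ^ y * m ^ m)
    ≡⟨ regroupˡ (D + 22) (n C suc k) k (y ^ k) (m ^ m) ⟩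
  (n C suc k) * y * ((D + 22) * (y ^ k * m ^ m))
    ≡⟨ cong (_* ((D + 22) * (y ^ k * m ^ m))) (nC[1+k]*[1+k]≡nCk*[n∸k] k<n) ⟩
  (n C k) * (n ∸ k) * ((D + 22) * (y ^ k * m ^ m))
    ≡⟨ cong (λ r → (n C k) * r * ((D + 22) * (y ^ k * m ^ m))) n∸k≡1+m ⟩
  (n C k) * suc m * ((D + 22) * (y ^ k * m ^ m))
    <⟨ *-monoʳ-< ((n C k) * suc m) (euler-ratio 1+k≤m) ⟩
  (n C k) * suc m * (D * (k ^ k * suc m ^ m))
    ≡⟨ regroupʳ (n C k) m D (k ^ k) (suc m ^ m) ⟩
  D * ((n C k) * k ^ k * suc m ^ suc m)
    ≡⟨ cong (λ r → D * ((n C k) * k ^ k * r ^ r)) n∸k≡1+m ⟨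
  D * ((n C k) * k ^ k * (n ∸ k) ^ (n ∸ k))
    ∎
  where
  open ≤-Reasoning
  y = suc k
  D = 48 * (y * y)
  m = n ∸ y
  k<n : k < n
  k<n = m+n≤o⇒m≤o y 2[1+k]≤n
  n∸k≡1+m : n ∸ k ≡ suc m
  n∸k≡1+m = +-∸-assoc 1 k<n
  1+k≤m : y ≤ m
  1+k≤m = m+n≤o⇒m≤o∸n y 2[1+k]≤n
  instance _ = >-nonZero (*-mono-< (nCk>0 (<⇒≤ k<n)) (z<s {m}))
  regroupˡ : ∀ e c k Y M → e * (c * (suc k * Y) * M) ≡ c * suc k * (e * (Y * M))
  regroupˡ = solve-∀
  regroupʳ : ∀ c m d K X → c * suc m * (d * (K * X)) ≡ d * (c * K * (suc m * X))
  regroupʳ = solve-∀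

open ExponentialBound using (expMulLt-exponent)

lemma2p1 : (n k : ℕ) → 3 ≤ n → k + 1 ≤ n / 2 →
    ExpMulLt (exponent n)
    ((n C (k + 1)) * (k + 1) ^ (k + 1) * (n ∸ k ∸ 1) ^ (n ∸ k ∸ 1))
    ((n C k) * k ^ k * (n ∸ k) ^ (n ∸ k))
lemma2p1 n k _ k+1≤n/2 rewrite ∸-+-assoc n k 1 | +-comm k 1 =
  expMulLt-exponent n (48 * (suc k * suc k)) _ _ 22≤D D≤12n² (binomial-term-ratio 2[1+k]≤n)
  where
  2[1+k]≤n : suc k + suc k ≤ n
  2[1+k]≤n = m≤n/2⇒m+m≤n k+1≤n/2
  22≤D : 22 ≤ 48 * (suc k * suc k)
  22≤D = ≤-trans (≤ᵇ⇒≤ 22 48 _) (m≤m*n 48 (suc k * suc k))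
  D≤12n² : 48 * (suc k * suc k) ≤ 12 * n * n
  D≤12n² = ≤-trans (≤-reflexive (quadruple k)) (*-mono-≤ (*-monoʳ-≤ 12 2[1+k]≤n) 2[1+k]≤n)
    where
    quadruple : ∀ k → 48 * (suc k * suc k) ≡ 12 * (suc k + suc k) * (suc k + suc k)
    quadruple = solve-∀
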